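{- Let $r\in \mathbb{N}$ with $r\ge 4$ and $\mu>0$. Then there exists $\alpha>0$ such that the following holds for all sufficiently large $n$. Let $G$ be an $n$-vertex graph with $\delta(G)\geq \left(\frac{1}{2}+\mu\right)n$ and $\alpha_{r-2}(G)\leq \alpha n$. If $W\subseteq V(G)$ with $|W|\leq \frac{\mu}{2}n$, then for each vertex $v\in V(G)\setminus W$ there exists a copy of $K_{r}$ in $G-W$ containing $v$.
   Context: For a graph $G$ and an integer $\ell\ge 2$, $\alpha_{\ell}(G)$ is the maximum size of a set $S\subseteq V(G)$ such that $G[S]$ contains no copy of $K_\ell$. $G-W$ denotes the subgraph of $G$ induced by $V(G)\setminus W$.
   Formalization: The parameter μ ranges over the positive rationals, and the constant α is taken in the rationals. -}

module Defs where

open import Data.Nat using (ℕ; zero; suc; _+_)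
open import Data.Bool using (Bool; true; false)
open import Data.Fin using (Fin)
open import Data.Fin.Subset using (Subset; _∈_; _⊆_; ∣_∣; ∁)
open import Data.Fin.Subset public using (Subset; _∈_; _∉_; _⊆_; ∣_∣; ∁)
open import Data.Vec using (tabulate)
open import Data.Integer using (+_)
open import Data.Rational using (ℚ; _/_)
open import Relation.Binary.PropositionalEquality using (_≡_; _≢_)
open import Data.Product using (Σ; _×_)
open import Relation.Nullary using (¬_)
open import Data.Rational using (_≤_; _*_)

record Graph (n : ℕ) : Set where
  field
    adj     : Fin n → Fin n → Bool
    symm    : ∀ u v → adj u v ≡ adj v u
    irrefl  : ∀ v → adj v v ≡ false
open Graph public

N : ∀ {n} → Graph n → Fin n → Subset n
N G v = tabulate (adj G v)

deg : ∀ {n} → Graph n → Fin n → ℕ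
deg G v = ∣ N G v ∣

toℚ : ℕ → ℚ
toℚ m = + m / 1

IsClique : ∀ {n} → Graph n → Subset n → Set
IsClique G K = ∀ u v → u ∈ K → v ∈ K → u ≢ v → adj G u v ≡ true

ContainsK : ∀ {n} → Graph n → ℕ → Subset n → Set
ContainsK {n} G ℓ S =
  Σ (Subset n) (λ K → ∣ K ∣ ≡ ℓ × K ⊆ S × IsClique G K)

-- α_ℓ(G) ≤ c : every vertex set S whose induced subgraph has no K_ℓ has |S| ≤ c
-- (equivalent to the maximum of such |S| being ≤ c)
αℓ≤ : ∀ {n} → Graph n → ℕ → ℚ → Set
αℓ≤ {n} G ℓ c = ∀ (S : Subset n) → ¬ ContainsK G ℓ S → toℚ ∣ S ∣ ≤ c

δ≥ : ∀ {n} → Graph n → ℚ → Set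
δ≥ {n} G c = ∀ (v : Fin n) → c ≤ toℚ (deg G v)

{-# OPTIONS --safe #-}
-- Take α = μ. For any vertices u and v, the common neighbourhood of u and v outside W
-- has at least deg u + deg v − n − |W| ≥ 2(½ + μ)n − n − μn/2 = 3μn/2 > αn vertices.
-- With u = v this shows that v has a neighbour u outside W; for such u, the bound on
-- α_{r−2} gives a K_{r−2} in the common neighbourhood, which with u and v is a K_r.
module Submission where

open import Defs
open import Data.Nat using (ℕ; _∸_) renaming (_≤_ to _≤ℕ_)
open import Data.Fin using (Fin)
open import Data.Product using (Σ; _×_)
open import Data.Rational using (ℚ; _<_; _≤_; _+_; _*_; ½; 0ℚ)
open import Relation.Binary.PropositionalEquality using (_≡_)

open import Data.Bool using (true) renaming (_≟_ to _≟ᵇ_)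
open import Data.Empty using (⊥-elim)
open import Data.Fin.Subset using (_∩_; _∪_; ⁅_⁆; inside; outside; Nonempty)
open import Data.Fin.Subset.Properties
  using (anySubset?; _⊆?_; _∈?_; ∪-identityˡ;
         p∩q⊆p; p∩q⊆q; x∈p∪q⁺; x∈p∪q⁻; x∈⁅y⁆⇒x≡y; x∈⁅x⁆;
         x∉p⇒x∈∁p)
import Data.Fin.Properties as Fin
import Data.Integer as ℤ
import Data.Integer.Properties as ℤ
import Data.Nat as ℕ
import Data.Nat.Properties as ℕ
open import Data.Nat.Coprimality using (1-coprimeTo) renaming (sym to coprime-sym)
open import Data.Product using (_,_; proj₁; proj₂)
open import Data.Rational using (mkℚ; _/_; positive; *≤*; *<*)
open import Data.Rational.Properties
  using (normalize-coprime; <-irrefl; <-trans; <-≤-trans; ≰⇒>;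
         +-mono-≤; +-monoʳ-≤; +-monoʳ-<; +-identityʳ; pos*pos⇒pos; positive⁻¹;
         module ≤-Reasoning)
open import Data.Rational.Solver using (module +-*-Solver)
open import Data.Sum using (_⊎_; inj₁; inj₂)
open import Data.Vec using ([]; _∷_; here; there)
open import Data.Vec.Properties using ([]=⇒lookup; lookup∘tabulate)
open import Function using (_∘_)
open import Relation.Nullary using (Dec; yes; no; ¬_)
open import Relation.Nullary.Decidable using (_×-dec_; _→-dec_; ¬?)
open import Relation.Binary.PropositionalEquality using (refl; sym; trans; cong; cong₂; subst₂)

private
  variable
    n : ℕ
    x : Fin n
    p : Subset n

∣p∣+∣q∣≤n+∣p∩q∣ : ∀ (p q : Subset n) → ∣ p ∣ ℕ.+ ∣ q ∣ ≤ℕ n ℕ.+ ∣ p ∩ q ∣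
∣p∣+∣q∣≤n+∣p∩q∣ [] [] = ℕ.z≤n
∣p∣+∣q∣≤n+∣p∩q∣ {ℕ.suc n} (inside ∷ p) (inside ∷ q)
  rewrite ℕ.+-suc ∣ p ∣ ∣ q ∣ | ℕ.+-suc n ∣ p ∩ q ∣ = ℕ.s≤s (ℕ.s≤s (∣p∣+∣q∣≤n+∣p∩q∣ p q))
∣p∣+∣q∣≤n+∣p∩q∣ (inside ∷ p) (outside ∷ q) = ℕ.s≤s (∣p∣+∣q∣≤n+∣p∩q∣ p q)
∣p∣+∣q∣≤n+∣p∩q∣ (outside ∷ p) (inside ∷ q)
  rewrite ℕ.+-suc ∣ p ∣ ∣ q ∣ = ℕ.s≤s (∣p∣+∣q∣≤n+∣p∩q∣ p q)
∣p∣+∣q∣≤n+∣p∩q∣ (outside ∷ p) (outside ∷ q) = ℕ.m≤n⇒m≤1+n (∣p∣+∣q∣≤n+∣p∩q∣ p q)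

∣p∣≤∣p∩∁q∣+∣q∣ : ∀ (p q : Subset n) → ∣ p ∣ ≤ℕ ∣ p ∩ ∁ q ∣ ℕ.+ ∣ q ∣
∣p∣≤∣p∩∁q∣+∣q∣ [] [] = ℕ.z≤n
∣p∣≤∣p∩∁q∣+∣q∣ (inside ∷ p) (inside ∷ q)
  rewrite ℕ.+-suc ∣ p ∩ ∁ q ∣ ∣ q ∣ = ℕ.s≤s (∣p∣≤∣p∩∁q∣+∣q∣ p q)
∣p∣≤∣p∩∁q∣+∣q∣ (inside ∷ p) (outside ∷ q) = ℕ.s≤s (∣p∣≤∣p∩∁q∣+∣q∣ p q)
∣p∣≤∣p∩∁q∣+∣q∣ (outside ∷ p) (inside ∷ q)
  rewrite ℕ.+-suc ∣ p ∩ ∁ q ∣ ∣ q ∣ = ℕ.m≤n⇒m≤1+n (∣p∣≤∣p∩∁q∣+∣q∣ p q)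
∣p∣≤∣p∩∁q∣+∣q∣ (outside ∷ p) (outside ∷ q) = ∣p∣≤∣p∩∁q∣+∣q∣ p q

∣p∣+∣q∣≤n+∣p∩[q∩∁r]∣+∣r∣ : ∀ (p q r : Subset n) →
  ∣ p ∣ ℕ.+ ∣ q ∣ ≤ℕ n ℕ.+ ∣ p ∩ (q ∩ ∁ r) ∣ ℕ.+ ∣ r ∣
∣p∣+∣q∣≤n+∣p∩[q∩∁r]∣+∣r∣ {n} p q r = begin
  ∣ p ∣ ℕ.+ ∣ q ∣                           ≤⟨ ℕ.+-monoʳ-≤ ∣ p ∣ (∣p∣≤∣p∩∁q∣+∣q∣ q r) ⟩
  ∣ p ∣ ℕ.+ (∣ q ∩ ∁ r ∣ ℕ.+ ∣ r ∣)         ≡⟨ ℕ.+-assoc ∣ p ∣ _ _ ⟨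
  ∣ p ∣ ℕ.+ ∣ q ∩ ∁ r ∣ ℕ.+ ∣ r ∣           ≤⟨ ℕ.+-monoˡ-≤ ∣ r ∣ (∣p∣+∣q∣≤n+∣p∩q∣ p (q ∩ ∁ r)) ⟩
  n ℕ.+ ∣ p ∩ (q ∩ ∁ r) ∣ ℕ.+ ∣ r ∣         ∎
  where open ℕ.≤-Reasoning

∣p∣>0⇒Nonempty : ∀ (p : Subset n) → 0 ℕ.< ∣ p ∣ → Nonempty p
∣p∣>0⇒Nonempty (inside ∷ p)  _     = Fin.zero , here
∣p∣>0⇒Nonempty (outside ∷ p) ∣p∣>0 with ∣p∣>0⇒Nonempty p ∣p∣>0
... | x , x∈p = Fin.suc x , there x∈p

∣⁅x⁆∪p∣≡1+∣p∣ : x ∉ p → ∣ ⁅ x ⁆ ∪ p ∣ ≡ ℕ.suc ∣ p ∣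
∣⁅x⁆∪p∣≡1+∣p∣ {x = Fin.zero}  {inside ∷ p}  x∉p = ⊥-elim (x∉p here)
∣⁅x⁆∪p∣≡1+∣p∣ {x = Fin.zero}  {outside ∷ p} x∉p = cong (ℕ.suc ∘ ∣_∣) (∪-identityˡ p)
∣⁅x⁆∪p∣≡1+∣p∣ {x = Fin.suc x} {inside ∷ p}  x∉p = cong ℕ.suc (∣⁅x⁆∪p∣≡1+∣p∣ (x∉p ∘ there))
∣⁅x⁆∪p∣≡1+∣p∣ {x = Fin.suc x} {outside ∷ p} x∉p = ∣⁅x⁆∪p∣≡1+∣p∣ (x∉p ∘ there)

toℚ≡mkℚ : ∀ m → toℚ m ≡ mkℚ (ℤ.+ m) 0 (coprime-sym (1-coprimeTo m))
toℚ≡mkℚ m = normalize-coprime (coprime-sym (1-coprimeTo m))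

toℚ-mono-≤ : ∀ {m k} → m ≤ℕ k → toℚ m ≤ toℚ k
toℚ-mono-≤ {m} {k} m≤k rewrite toℚ≡mkℚ m | toℚ≡mkℚ k =
  *≤* (subst₂ ℤ._≤_ (sym (ℤ.*-identityʳ (ℤ.+ m))) (sym (ℤ.*-identityʳ (ℤ.+ k))) (ℤ.+≤+ m≤k))

toℚ-mono-< : ∀ {m k} → m ℕ.< k → toℚ m < toℚ k
toℚ-mono-< {m} {k} m<k rewrite toℚ≡mkℚ m | toℚ≡mkℚ k =
  *<* (subst₂ ℤ._<_ (sym (ℤ.*-identityʳ (ℤ.+ m))) (sym (ℤ.*-identityʳ (ℤ.+ k))) (ℤ.+<+ m<k))

toℚ-+ : ∀ m k → toℚ (m ℕ.+ k) ≡ toℚ m + toℚ k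
toℚ-+ m k rewrite toℚ≡mkℚ m | toℚ≡mkℚ k =
  cong (_/ 1) (sym (cong₂ ℤ._+_ (ℤ.*-identityʳ (ℤ.+ m)) (ℤ.*-identityʳ (ℤ.+ k))))

toℚ-cancel-< : ∀ {m k} → toℚ m < toℚ k → m ℕ.< k
toℚ-cancel-< m<k = ℕ.≰⇒> λ k≤m → <-irrefl refl (<-≤-trans m<k (toℚ-mono-≤ k≤m))

Fin⇒toℚ>0 : Fin n → 0ℚ < toℚ n
Fin⇒toℚ>0 x = toℚ-mono-< (ℕ.≤-<-trans ℕ.z≤n (Fin.toℕ<n x))

½+μ-degrees⇒μm<c : ∀ {μ m d₁ d₂ c w} → 0ℚ < μ → 0ℚ < m →
  (½ + μ) * m ≤ d₁ → (½ + μ) * m ≤ d₂ → w ≤ (μ * ½) * m → d₁ + d₂ ≤ m + c + w →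
  μ * m < c
½+μ-degrees⇒μm<c {μ} {m} {d₁} {d₂} {c} {w} μ>0 m>0 d₁-large d₂-large w-small d₁+d₂≤ =
  ≰⇒> c≰μm
  where
  open ≤-Reasoning
  open +-*-Solver

  ε = (μ * ½) * m

  ε>0 : 0ℚ < ε
  ε>0 = positive⁻¹ ε {{pos*pos⇒pos (μ * ½) {{pos*pos⇒pos μ {{positive μ>0}} ½}} m {{positive m>0}}}}

  m+μm+ε+ε≡[½+μ]m+[½+μ]m : m + μ * m + ε + ε ≡ (½ + μ) * m + (½ + μ) * m
  m+μm+ε+ε≡[½+μ]m+[½+μ]m = solve 2
    (λ μ m → m :+ μ :* m :+ μ :* con ½ :* m :+ μ :* con ½ :* m
             := (con ½ :+ μ) :* m :+ (con ½ :+ μ) :* m) refl μ m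

  c≰μm : ¬ c ≤ μ * m
  c≰μm c≤μm = <-irrefl refl (begin-strict
    m + μ * m + ε + ε            ≡⟨ m+μm+ε+ε≡[½+μ]m+[½+μ]m ⟩
    (½ + μ) * m + (½ + μ) * m    ≤⟨ +-mono-≤ d₁-large d₂-large ⟩
    d₁ + d₂                      ≤⟨ d₁+d₂≤ ⟩
    m + c + w                    ≤⟨ +-mono-≤ (+-monoʳ-≤ m c≤μm) w-small ⟩
    m + μ * m + ε                ≡⟨ +-identityʳ _ ⟨
    m + μ * m + ε + 0ℚ           <⟨ +-monoʳ-< (m + μ * m + ε) ε>0 ⟩
    m + μ * m + ε + ε            ∎)

module _ (G : Graph n) where

  ∈N⇒adj : ∀ {u v} → v ∈ N G u → adj G u v ≡ true
  ∈N⇒adj {u} {v} v∈Nu = trans (sym (lookup∘tabulate (adj G u) v)) ([]=⇒lookup v∈Nu)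

  x∉N[x] : x ∉ N G x
  x∉N[x] {x = x} x∈Nx with trans (sym (irrefl G x)) (∈N⇒adj x∈Nx)
  ... | ()

  ∈⁅x⁆∪p⁻ : ∀ {y} → y ∈ ⁅ x ⁆ ∪ p → y ≡ x ⊎ y ∈ p
  ∈⁅x⁆∪p⁻ {x = x} {p = p} y∈ with x∈p∪q⁻ ⁅ x ⁆ p y∈
  ... | inj₁ y∈⁅x⁆ = inj₁ (x∈⁅y⁆⇒x≡y x y∈⁅x⁆)
  ... | inj₂ y∈p   = inj₂ y∈p

  IsClique-⁅x⁆∪ : IsClique G p → p ⊆ N G x → IsClique G (⁅ x ⁆ ∪ p)
  IsClique-⁅x⁆∪ {p = p} {x = x} clique p⊆Nx y z y∈ z∈ y≢z with ∈⁅x⁆∪p⁻ y∈ | ∈⁅x⁆∪p⁻ z∈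
  ... | inj₁ refl | inj₁ refl = ⊥-elim (y≢z refl)
  ... | inj₁ refl | inj₂ z∈p  = ∈N⇒adj (p⊆Nx z∈p)
  ... | inj₂ y∈p  | inj₁ refl = trans (symm G y x) (∈N⇒adj (p⊆Nx y∈p))
  ... | inj₂ y∈p  | inj₂ z∈p  = clique y z y∈p z∈p y≢z

  IsClique? : ∀ K → Dec (IsClique G K)
  IsClique? K = Fin.all? λ u → Fin.all? λ v →
    (u ∈? K) →-dec (v ∈? K) →-dec ¬? (u Fin.≟ v) →-dec (adj G u v ≟ᵇ true)

  ContainsK? : ∀ ℓ S → Dec (ContainsK G ℓ S)
  ContainsK? ℓ S = anySubset? λ K → (∣ K ∣ ℕ.≟ ℓ) ×-dec (K ⊆? S) ×-dec IsClique? K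

  αℓ≤⇒ContainsK : ∀ {ℓ c} → αℓ≤ G ℓ c → ∀ S → c < toℚ ∣ S ∣ → ContainsK G ℓ S
  αℓ≤⇒ContainsK α-bound S c<∣S∣ with ContainsK? _ S
  ... | yes K⊆S = K⊆S
  ... | no ¬K⊆S = ⊥-elim (<-irrefl refl (<-≤-trans c<∣S∣ (α-bound S ¬K⊆S)))

  ⁅x⁆∪-clique : ∀ {K S ℓ} → x ∈ S → ∣ K ∣ ≡ ℓ → K ⊆ N G x ∩ S → IsClique G K →
    ∣ ⁅ x ⁆ ∪ K ∣ ≡ ℕ.suc ℓ × ⁅ x ⁆ ∪ K ⊆ S × IsClique G (⁅ x ⁆ ∪ K) × x ∈ ⁅ x ⁆ ∪ K
  ⁅x⁆∪-clique {x = x} {K} {S} x∈S refl K⊆Nx∩S clique =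
    ∣⁅x⁆∪p∣≡1+∣p∣ (x∉N[x] ∘ K⊆Nx) , ⁅x⁆∪K⊆S , IsClique-⁅x⁆∪ clique K⊆Nx , x∈p∪q⁺ (inj₁ (x∈⁅x⁆ x))
    where
    K⊆Nx : K ⊆ N G x
    K⊆Nx = p∩q⊆p (N G x) S ∘ K⊆Nx∩S
    ⁅x⁆∪K⊆S : ⁅ x ⁆ ∪ K ⊆ S
    ⁅x⁆∪K⊆S y∈ with ∈⁅x⁆∪p⁻ y∈
    ... | inj₁ refl = x∈S
    ... | inj₂ y∈K  = p∩q⊆q (N G x) S (K⊆Nx∩S y∈K)

  common-neighbourhood-large : ∀ {μ W} → 0ℚ < μ → δ≥ G ((½ + μ) * toℚ n) →
    toℚ ∣ W ∣ ≤ (μ * ½) * toℚ n → ∀ u v → μ * toℚ n < toℚ ∣ N G u ∩ (N G v ∩ ∁ W) ∣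
  common-neighbourhood-large {W = W} μ>0 δ-bound W-small u v =
    ½+μ-degrees⇒μm<c μ>0 (Fin⇒toℚ>0 u) (δ-bound u) (δ-bound v) W-small degree-sum
    where
    open ≤-Reasoning
    C = N G u ∩ (N G v ∩ ∁ W)
    degree-sum : toℚ (deg G u) + toℚ (deg G v) ≤ toℚ n + toℚ ∣ C ∣ + toℚ ∣ W ∣
    degree-sum = begin
      toℚ (deg G u) + toℚ (deg G v)         ≡⟨ toℚ-+ (deg G u) (deg G v) ⟨
      toℚ (deg G u ℕ.+ deg G v)             ≤⟨ toℚ-mono-≤ (∣p∣+∣q∣≤n+∣p∩[q∩∁r]∣+∣r∣ (N G u) (N G v) W) ⟩
      toℚ (n ℕ.+ ∣ C ∣ ℕ.+ ∣ W ∣)           ≡⟨ toℚ-+ (n ℕ.+ ∣ C ∣) ∣ W ∣ ⟩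
      toℚ (n ℕ.+ ∣ C ∣) + toℚ ∣ W ∣         ≡⟨ cong (_+ toℚ ∣ W ∣) (toℚ-+ n ∣ C ∣) ⟩
      toℚ n + toℚ ∣ C ∣ + toℚ ∣ W ∣         ∎

lemma5p5 : ∀ (r : ℕ) → 4 ≤ℕ r → ∀ (μ : ℚ) → 0ℚ < μ →
    Σ ℚ λ α → 0ℚ < α × Σ ℕ λ n₀ → ∀ (n : ℕ) → n₀ ≤ℕ n →
      ∀ (G : Graph n) →
        δ≥ G ((½ + μ) * toℚ n) →
        αℓ≤ G (r ∸ 2) (α * toℚ n) →
        ∀ (W : Subset n) → toℚ ∣ W ∣ ≤ (μ * ½) * toℚ n →
        ∀ (v : Fin n) → v ∉ W →
        Σ (Subset n) λ K → ∣ K ∣ ≡ r × K ⊆ ∁ W × IsClique G K × v ∈ K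
lemma5p5 0 ()
lemma5p5 1 (ℕ.s≤s ())
lemma5p5 (ℕ.suc (ℕ.suc ℓ)) _ μ μ>0 = μ , μ>0 , 0 , clique-through
  where
  clique-through : ∀ n → 0 ≤ℕ n → (G : Graph n) → δ≥ G ((½ + μ) * toℚ n) → αℓ≤ G ℓ (μ * toℚ n) →
    ∀ W → toℚ ∣ W ∣ ≤ (μ * ½) * toℚ n → ∀ v → v ∉ W →
    Σ (Subset n) λ K → ∣ K ∣ ≡ ℕ.suc (ℕ.suc ℓ) × K ⊆ ∁ W × IsClique G K × v ∈ K
  clique-through n _ G δ-bound α-bound W W-small v v∉W =
    let u , u∈Nv∩[Nv∩∁W]        = ∣p∣>0⇒Nonempty _ (toℚ-cancel-< (<-trans μn>0 (large v v)))
        K₀ , ∣K₀∣ , K₀⊆ , K₀-clique = αℓ≤⇒ContainsK G α-bound _ (large u v)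
        ∣K₁∣ , K₁⊆ , K₁-clique , _  = ⁅x⁆∪-clique G (p∩q⊆q (N G v) _ u∈Nv∩[Nv∩∁W]) ∣K₀∣ K₀⊆ K₀-clique
    in ⁅ v ⁆ ∪ (⁅ u ⁆ ∪ K₀) , ⁅x⁆∪-clique G (x∉p⇒x∈∁p v∉W) ∣K₁∣ K₁⊆ K₁-clique
    where
    large : ∀ u v → μ * toℚ n < toℚ ∣ N G u ∩ (N G v ∩ ∁ W) ∣
    large = common-neighbourhood-large G μ>0 δ-bound W-small
    μn>0 : 0ℚ < μ * toℚ n
    μn>0 = positive⁻¹ _ {{pos*pos⇒pos μ {{positive μ>0}} (toℚ n) {{positive (Fin⇒toℚ>0 v)}}}}
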